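{- Let $D$ be a defeasible theory and $q$ a ground literal of $D$ (written $p(\vec a)$ or $\neg p(\vec a)$ in $D$, and represented by $\mathtt{p}(\vec a)$ or $\mathtt{not\_p}(\vec a)$ in $\mathcal M_{\partial_{||}}(D)$). Then $q\in P_\Delta$ iff $\mathcal M_{\partial_{||}}(D)\models_{WF}\mathtt{definitely}(q)$, and $q\in P_\lambda$ iff $\mathcal M_{\partial_{||}}(D)\models_{WF}\mathtt{lambda}(q)$.
   Context: Defeasible theories. A literal is an atom $p(t_1,\dots,t_n)$ or its classical negation $\neg p(t_1,\dots,t_n)$; ${\sim}q$ is the complementary literal. A defeasible theory $D=(F,R,>)$ has a finite set $F$ of variable-free literals (facts), a finite set $R$ of labelled rules $r$ with antecedent set $A(r)$, consequent $C(r)$ and kind strict ($\to$), defeasible ($\Rightarrow$) or defeater ($\leadsto$), and an acyclic superiority relation $>$ on labels. $R_s$: strict rules; $R_{sd}$: strict or defeasible rules; $R[q]$: rules with consequent $q$. A non-ground theory is identified with the set of ground instances of its rules. $P_\Delta$ is the least set of ground literals with $q\in P_\Delta$ whenever $q\in F$ or some $r\in R_s[q]$ has $A(r)\subseteq P_\Delta$. $P_\lambda$ is the least set with $q\in P_\lambda$ whenever $q\in P_\Delta$, or some $r\in R_{sd}[q]$ has $A(r)\subseteq P_\lambda$ and ${\sim}q\notin P_\Delta$. Metaprogram. $D$ is represented by unit clauses $\mathtt{fact}(q)$ ($q\in F$), $\mathtt{strict}(r,q,[q_1,\dots,q_n])$, $\mathtt{defeasible}(r,q,[q_1,\dots,q_n])$,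 $\mathtt{defeater}(r,q,[q_1,\dots,q_n])$ (for rules $r:q_1,\dots,q_n\hookrightarrow q$ of the respective kind), $\mathtt{sup}(r,s)$ ($r>s$), with predicates of $D$ as function symbols and $\neg p(\vec t)$ written $\mathtt{not\_p}(\vec t)$; and for each predicate $p$, $\mathtt{neg}(\mathtt{p}(\vec X),\mathtt{not\_p}(\vec X))$ and $\mathtt{neg}(\mathtt{not\_p}(\vec X),\mathtt{p}(\vec X))$. $\mathcal M_{\partial_{||}}(D)$ is this together with: $\mathtt{rule}(R,H,B)\,\text{:- }\,\mathtt{strict\_or\_defeasible}(R,H,B)$; $\mathtt{rule}(R,H,B)\,\text{:- }\,\mathtt{defeater}(R,H,B)$; $\mathtt{strict\_or\_defeasible}(R,H,B)\,\text{:- }\,\mathtt{strict}(R,H,B)$; $\mathtt{strict\_or\_defeasible}(R,H,B)\,\text{:- }\,\mathtt{defeasible}(R,H,B)$; for $\tau\in\{\mathtt{definitely},\mathtt{lambda},\mathtt{defeasibly}\}$: $\mathtt{loop\_}\tau([\,])$, $\mathtt{loop\_}\tau([H|T])\,\text{:- }\,\tau(H),\mathtt{loop\_}\tau(T)$; $\mathtt{definitely}(X)\,\text{:- }\,\mathtt{fact}(X)$; $\mathtt{definitely}(X)\,\text{:- }\,\mathtt{strict}(R,X,Y),\mathtt{loop\_definitely}(Y)$; $\mathtt{lambda}(X)\,\text{:- }\,\mathtt{definitely}(X)$; $\mathtt{lambda}(X)\,\text{:- }\,\mathtt{neg}(X,X'),\ not\ \mathtt{definitely}(X'),\ \mathtt{strict\_or\_defeasible}(R,X,Y),\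 \mathtt{loop\_lambda}(Y)$; $\mathtt{defeasibly}(X)\,\text{:- }\,\mathtt{definitely}(X)$; $\mathtt{defeasibly}(X)\,\text{:- }\,\mathtt{neg}(X,X'),\ not\ \mathtt{definitely}(X'),\ \mathtt{strict\_or\_defeasible}(R,X,Y),\ \mathtt{loop\_defeasibly}(Y),\ not\ \mathtt{overruled}(X)$; $\mathtt{overruled}(X)\,\text{:- }\,\mathtt{neg}(X,X'),\ \mathtt{rule}(S,X',U),\ \mathtt{loop\_lambda}(U),\ not\ \mathtt{defeated}(S,X')$; $\mathtt{defeated}(S,X')\,\text{:- }\,\mathtt{neg}(X,X'),\ \mathtt{sup}(T,S),\ \mathtt{strict\_or\_defeasible}(T,X,V),\ \mathtt{loop\_defeasibly}(V)$. $P\models_{WF}\ell$ means the ground literal $\ell$ holds in the well-founded model of the logic program $P$. -}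

module Defs where

open import Data.Nat using (ℕ)
open import Data.Bool using (Bool; true; false; not)
open import Data.List using (List; []; _∷_; _++_; map; concatMap; length; upTo)
open import Data.List.Relation.Unary.All using (All)
open import Data.List.Membership.Propositional using (_∈_)
open import Data.Product using (_×_; _,_)
open import Data.Empty using (⊥)
open import Function using (id)
open import Relation.Nullary using (¬_)
open import Relation.Binary.PropositionalEquality using (_≡_)

data Term (F V : Set) : Set where
  var : V → Term F V
  fn  : F → List (Term F V) → Term F V

mutual
  mapT : ∀ {F G V W : Set} → (F → G) → (V → Term G W) → Term F V → Term G W
  mapT g σ (var x)   = σ x
  mapT g σ (fn f ts) = fn (g f) (mapTs g σ ts)

  mapTs : ∀ {F G V W : Set} → (F → G) → (V → Term G W) → List (Term F V) → List (Term G W)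
  mapTs g σ []       = []
  mapTs g σ (t ∷ ts) = mapT g σ t ∷ mapTs g σ ts

-- Defeasible theories.
-- Predicate symbols, function symbols (constants = 0-ary) of D, rule
-- labels and variables are all named by natural numbers.

-- literal: positive = true is p(t⃗), positive = false is ¬p(t⃗)
record Lit (V : Set) : Set where
  constructor lit
  field
    positive : Bool
    pred     : ℕ
    args     : List (Term ℕ V)

GLit : Set
GLit = Lit ⊥

∼_ : ∀ {V} → Lit V → Lit V
∼ lit b p ts = lit (not b) p ts

data Kind : Set where
  strictK defeasibleK defeaterK : Kind

data StrictOrDefeasible : Kind → Set where
  isStrict     : StrictOrDefeasible strictK
  isDefeasible : StrictOrDefeasible defeasibleK

record Rule : Set where
  constructor mkRule
  field
    label      : ℕ
    kind       : Kind
    antecedent : List (Lit ℕ)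
    consequent : Lit ℕ

record Theory : Set where
  constructor theory
  field
    facts : List GLit
    rules : List Rule
    sup   : List (ℕ × ℕ)           -- (r , s) ∈ sup  means  r > s

open Rule public
open Theory public

data Sup⁺ (D : Theory) : ℕ → ℕ → Set where
  base : ∀ {r s}   → (r , s) ∈ sup D → Sup⁺ D r s
  step : ∀ {r s t} → (r , s) ∈ sup D → Sup⁺ D s t → Sup⁺ D r t

Acyclic : Theory → Set
Acyclic D = ∀ r → ¬ Sup⁺ D r r

DSubst : Set
DSubst = ℕ → Term ℕ ⊥

substL : DSubst → Lit ℕ → GLit
substL σ (lit b p ts) = lit b p (mapTs id σ ts)

data PΔ (D : Theory) : GLit → Set where
  fromFact   : ∀ {q} → q ∈ facts D → PΔ D q
  fromStrict : ∀ {r} → r ∈ rules D → kind r ≡ strictK → (σ : DSubst) →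
               All (PΔ D) (map (substL σ) (antecedent r)) →
               PΔ D (substL σ (consequent r))

data Pλ (D : Theory) : GLit → Set where
  fromΔ    : ∀ {q} → PΔ D q → Pλ D q
  fromRule : ∀ {r} → r ∈ rules D → StrictOrDefeasible (kind r) → (σ : DSubst) →
             All (Pλ D) (map (substL σ) (antecedent r)) →
             ¬ PΔ D (∼ substL σ (consequent r)) →
             Pλ D (substL σ (consequent r))

sig : ∀ {V} → Lit V → ℕ × ℕ
sig (lit _ p ts) = p , length ts

preds : Theory → List (ℕ × ℕ)
preds D = map sig (facts D)
       ++ concatMap (λ r → sig (consequent r) ∷ map sig (antecedent r)) (rules D)

data MFun : Set where
  dsym   : ℕ → MFun        -- function symbols of D
  predS  : ℕ → MFun        -- p      (predicate p of D as function symbol)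
  notS   : ℕ → MFun        -- not_p
  labS   : ℕ → MFun        -- rule labels
  nilS   : MFun
  consS  : MFun

data MPred : Set where
  factP strictP defeasibleP defeaterP supP negP : MPred
  ruleP strictOrDefeasibleP : MPred
  loopDefinitelyP loopLambdaP loopDefeasiblyP : MPred
  definitelyP lambdaP defeasiblyP overruledP defeatedP : MPred

MTerm : Set → Set
MTerm V = Term MFun V

record Atom (V : Set) : Set where
  constructor _⦅_⦆
  field
    apred : MPred
    aargs : List (MTerm V)

GAtom : Set
GAtom = Atom ⊥

record Clause : Set where
  constructor _:-_,not_
  field
    head    : Atom ℕ
    posBody : List (Atom ℕ)
    negBody : List (Atom ℕ)

Program : Set
Program = List Clause

-- ground instances (over the full Herbrand universe of MFun)
MSubst : Set
MSubst = ℕ → MTerm ⊥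

instA : MSubst → Atom ℕ → GAtom
instA σ (p ⦅ ts ⦆) = p ⦅ mapTs id σ ts ⦆

-- Γ_P(I): least model of the Gelfond–Lifschitz reduct P^I
data Γ (P : Program) (I : GAtom → Set) : GAtom → Set where
  apply : ∀ {c} → c ∈ P → (σ : MSubst) →
          All (λ a → ¬ I (instA σ a)) (Clause.negBody c) →
          All (λ a → Γ P I (instA σ a)) (Clause.posBody c) →
          Γ P I (instA σ (Clause.head c))

-- well-founded model (alternating fixpoint): the true atoms are the
-- least fixpoint of the monotone operator Γ_P ∘ Γ_P
_⊨WF_ : Program → GAtom → Set₁
P ⊨WF a = ∀ (S : GAtom → Set) → (∀ b → Γ P (Γ P S) b → S b) → S a

encT : ∀ {V} → Term ℕ V → MTerm V
encT = mapT dsym var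

encL : ∀ {V} → Lit V → MTerm V
encL (lit true  p ts) = fn (predS p) (mapTs dsym var ts)
encL (lit false p ts) = fn (notS p)  (mapTs dsym var ts)

encLs : ∀ {V} → List (Lit V) → MTerm V
encLs []       = fn nilS []
encLs (q ∷ qs) = fn consS (encL q ∷ encLs qs ∷ [])

lab : ∀ {V} → ℕ → MTerm V
lab r = fn (labS r) []

ground→ : MTerm ⊥ → MTerm ℕ
ground→ = mapT id (λ ())

kindPred : Kind → MPred
kindPred strictK     = strictP
kindPred defeasibleK = defeasibleP
kindPred defeaterK   = defeaterP

factClause : GLit → Clause
factClause q = (factP ⦅ ground→ (encL q) ∷ [] ⦆) :- [] ,not []

ruleClause : Rule → Clause
ruleClause r =
  (kindPred (kind r) ⦅ lab (label r) ∷ encL (consequent r) ∷ encLs (antecedent r) ∷ [] ⦆)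
    :- [] ,not []

supClause : ℕ × ℕ → Clause
supClause (r , s) = (supP ⦅ lab r ∷ lab s ∷ [] ⦆) :- [] ,not []

negClauses : ℕ × ℕ → List Clause
negClauses (p , n) =
    ((negP ⦅ fn (predS p) xs ∷ fn (notS p) xs ∷ [] ⦆) :- [] ,not [])
  ∷ ((negP ⦅ fn (notS p) xs ∷ fn (predS p) xs ∷ [] ⦆) :- [] ,not [])
  ∷ []
  where xs = map var (upTo n)

-- the fixed clauses; variable numbering:
-- R=0 H=1 B=2 X=3 X'=4 Y=5 S=6 U=7 T=8 V=9
private
  R H B X X' Y S U T V : MTerm ℕ
  R = var 0
  H = var 1
  B = var 2
  X = var 3
  X' = var 4
  Y = var 5
  S = var 6
  U = var 7
  T = var 8
  V = var 9
  nil : MTerm ℕ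
  nil = fn nilS []
  cons : MTerm ℕ → MTerm ℕ → MTerm ℕ
  cons h t = fn consS (h ∷ t ∷ [])

loopClauses : MPred → MPred → List Clause
loopClauses loopP τ =
    ((loopP ⦅ nil ∷ [] ⦆) :- [] ,not [])
  ∷ ((loopP ⦅ cons H T ∷ [] ⦆) :- (τ ⦅ H ∷ [] ⦆ ∷ loopP ⦅ T ∷ [] ⦆ ∷ []) ,not [])
  ∷ []

fixedClauses : List Clause
fixedClauses =
    ((ruleP ⦅ R ∷ H ∷ B ∷ [] ⦆) :- (strictOrDefeasibleP ⦅ R ∷ H ∷ B ∷ [] ⦆ ∷ []) ,not [])
  ∷ ((ruleP ⦅ R ∷ H ∷ B ∷ [] ⦆) :- (defeaterP ⦅ R ∷ H ∷ B ∷ [] ⦆ ∷ []) ,not [])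
  ∷ ((strictOrDefeasibleP ⦅ R ∷ H ∷ B ∷ [] ⦆) :- (strictP ⦅ R ∷ H ∷ B ∷ [] ⦆ ∷ []) ,not [])
  ∷ ((strictOrDefeasibleP ⦅ R ∷ H ∷ B ∷ [] ⦆) :- (defeasibleP ⦅ R ∷ H ∷ B ∷ [] ⦆ ∷ []) ,not [])
  ∷ ((definitelyP ⦅ X ∷ [] ⦆) :- (factP ⦅ X ∷ [] ⦆ ∷ []) ,not [])
  ∷ ((definitelyP ⦅ X ∷ [] ⦆) :- (strictP ⦅ R ∷ X ∷ Y ∷ [] ⦆ ∷ loopDefinitelyP ⦅ Y ∷ [] ⦆ ∷ []) ,not [])
  ∷ ((lambdaP ⦅ X ∷ [] ⦆) :- (definitelyP ⦅ X ∷ [] ⦆ ∷ []) ,not [])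
  ∷ ((lambdaP ⦅ X ∷ [] ⦆)
       :- (negP ⦅ X ∷ X' ∷ [] ⦆ ∷ strictOrDefeasibleP ⦅ R ∷ X ∷ Y ∷ [] ⦆ ∷ loopLambdaP ⦅ Y ∷ [] ⦆ ∷ [])
       ,not (definitelyP ⦅ X' ∷ [] ⦆ ∷ []))
  ∷ ((defeasiblyP ⦅ X ∷ [] ⦆) :- (definitelyP ⦅ X ∷ [] ⦆ ∷ []) ,not [])
  ∷ ((defeasiblyP ⦅ X ∷ [] ⦆)
       :- (negP ⦅ X ∷ X' ∷ [] ⦆ ∷ strictOrDefeasibleP ⦅ R ∷ X ∷ Y ∷ [] ⦆ ∷ loopDefeasiblyP ⦅ Y ∷ [] ⦆ ∷ [])
       ,not (definitelyP ⦅ X' ∷ [] ⦆ ∷ overruledP ⦅ X ∷ [] ⦆ ∷ []))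
  ∷ ((overruledP ⦅ X ∷ [] ⦆)
       :- (negP ⦅ X ∷ X' ∷ [] ⦆ ∷ ruleP ⦅ S ∷ X' ∷ U ∷ [] ⦆ ∷ loopLambdaP ⦅ U ∷ [] ⦆ ∷ [])
       ,not (defeatedP ⦅ S ∷ X' ∷ [] ⦆ ∷ []))
  ∷ ((defeatedP ⦅ S ∷ X' ∷ [] ⦆)
       :- (negP ⦅ X ∷ X' ∷ [] ⦆ ∷ supP ⦅ T ∷ S ∷ [] ⦆ ∷ strictOrDefeasibleP ⦅ T ∷ X ∷ V ∷ [] ⦆
           ∷ loopDefeasiblyP ⦅ V ∷ [] ⦆ ∷ [])
       ,not [])
  ∷ []
  ++ loopClauses loopDefinitelyP definitelyP
  ++ loopClauses loopLambdaP lambdaP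
  ++ loopClauses loopDefeasiblyP defeasiblyP

Meta : Theory → Program
Meta D = map factClause (facts D)
      ++ map ruleClause (rules D)
      ++ map supClause (sup D)
      ++ concatMap negClauses (preds D)
      ++ fixedClauses

-- Both directions are inductions, one over the definition of P_Δ / P_λ
-- and one over derivations of the metaprogram, linked by the fixpoint
-- characterisation of the well-founded model: its true atoms form the
-- least set S with Γ(Γ S) ⊆ S.
--
-- Completeness: a derivation of q ∈ P_Δ (or P_λ) is replayed clause by
-- clause, which yields definitely(q) (resp. lambda(q)) in Γ(I) for every
-- interpretation I; for lambda the negative literal not definitely(∼q)
-- is discharged by soundness of definitely.
--
-- Soundness: an invariant on ground atoms (definitely(t) means the
-- literal decoded from t is in P_Δ, and so on) is shown to be closed
-- under Γ(Γ ·). The Herbrand universe of the metaprogram contains terms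
-- that encode no literal of D, so decoding maps its function symbols
-- injectively into ℕ, fixing the symbols of D and of q; this is what
-- lets the negative literal not definitely(X') be read back in D.
module Submission where

open import Defs
open import Data.Nat using (ℕ; zero; suc; _+_; _*_; _∸_; _<_; _≤_; _<?_)
open import Data.Nat.Properties using (m+n≤o⇒m≤o; m+n≤o⇒n≤o; m≤m+n; m≤n+m; ≤-trans; <⇒≱; m+n∸m≡n)
open import Data.Nat.ListAction using (sum)
open import Data.Bool using (true; false)
open import Data.Fin using (#_)
open import Data.List using (List; []; _∷_; map; length; upTo; applyUpTo; concatMap)
open import Data.List.Properties using (map-upTo)
open import Data.List.Relation.Unary.All as All using (All; []; _∷_)
open import Data.List.Relation.Unary.All.Properties using (++⁺; map⁺; concat⁺)
open import Data.List.Relation.Unary.Any using (here; there)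
open import Data.List.Membership.Propositional using (_∈_; lose)
open import Data.List.Membership.Propositional.Properties using (∈-++⁺ˡ; ∈-++⁺ʳ; ∈-map⁺; ∈-concatMap⁺; ∈-lookup)
open import Data.Product using (_×_; _,_; Σ)
open import Data.Unit using (⊤; tt)
open import Data.Empty using (⊥; ⊥-elim)
open import Relation.Nullary using (¬_; yes; no)
open import Relation.Binary.PropositionalEquality using (_≡_; refl; sym; trans; cong; cong₂; subst; module ≡-Reasoning)
open import Function using (id; _∘_)
open import Function.Bundles using (_⇔_; mk⇔)

open ≡-Reasoning

mutual
  mapT-∘ : ∀ {F G H V W X : Set} (g : G → H) (σ : W → Term H X) (h : F → G) (τ : V → Term G W)
           (t : Term F V) → mapT g σ (mapT h τ t) ≡ mapT (g ∘ h) (mapT g σ ∘ τ) t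
  mapT-∘ g σ h τ (var x)   = refl
  mapT-∘ g σ h τ (fn f ts) = cong (fn (g (h f))) (mapTs-∘ g σ h τ ts)

  mapTs-∘ : ∀ {F G H V W X : Set} (g : G → H) (σ : W → Term H X) (h : F → G) (τ : V → Term G W)
            (ts : List (Term F V)) → mapTs g σ (mapTs h τ ts) ≡ mapTs (g ∘ h) (mapT g σ ∘ τ) ts
  mapTs-∘ g σ h τ []       = refl
  mapTs-∘ g σ h τ (t ∷ ts) = cong₂ _∷_ (mapT-∘ g σ h τ t) (mapTs-∘ g σ h τ ts)

mutual
  mapT-identity : ∀ {F V : Set} {g : F → F} {σ : V → Term F V} →
                  (∀ f → g f ≡ f) → (∀ x → σ x ≡ var x) → (t : Term F V) → mapT g σ t ≡ t
  mapT-identity g≗id σ≗var (var x)   = σ≗var x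
  mapT-identity g≗id σ≗var (fn f ts) = cong₂ fn (g≗id f) (mapTs-identity g≗id σ≗var ts)

  mapTs-identity : ∀ {F V : Set} {g : F → F} {σ : V → Term F V} →
                   (∀ f → g f ≡ f) → (∀ x → σ x ≡ var x) → (ts : List (Term F V)) → mapTs g σ ts ≡ ts
  mapTs-identity g≗id σ≗var []       = refl
  mapTs-identity g≗id σ≗var (t ∷ ts) = cong₂ _∷_ (mapT-identity g≗id σ≗var t) (mapTs-identity g≗id σ≗var ts)

length-mapTs : ∀ {F G V W : Set} (g : F → G) (σ : V → Term G W) ts → length (mapTs g σ ts) ≡ length ts
length-mapTs g σ []       = refl
length-mapTs g σ (t ∷ ts) = cong suc (length-mapTs g σ ts)

data Bounded {V : Set} (N : ℕ) : Term ℕ V → Set where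
  var : ∀ {x} → Bounded N (var x)
  fn  : ∀ {f ts} → f < N → All (Bounded N) ts → Bounded N (fn f ts)

mutual
  mapT-cong-bounded : ∀ {G V W : Set} {N} {g g′ : ℕ → G} {σ σ′ : V → Term G W} →
                      (∀ f → f < N → g f ≡ g′ f) → (∀ x → σ x ≡ σ′ x) →
                      {t : Term ℕ V} → Bounded N t → mapT g σ t ≡ mapT g′ σ′ t
  mapT-cong-bounded g≈g′ σ≗σ′ (var {x})     = σ≗σ′ x
  mapT-cong-bounded g≈g′ σ≗σ′ (fn {f} f<N b) = cong₂ fn (g≈g′ f f<N) (mapTs-cong-bounded g≈g′ σ≗σ′ b)

  mapTs-cong-bounded : ∀ {G V W : Set} {N} {g g′ : ℕ → G} {σ σ′ : V → Term G W} →
                       (∀ f → f < N → g f ≡ g′ f) → (∀ x → σ x ≡ σ′ x) →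
                       {ts : List (Term ℕ V)} → All (Bounded N) ts → mapTs g σ ts ≡ mapTs g′ σ′ ts
  mapTs-cong-bounded g≈g′ σ≗σ′ []       = refl
  mapTs-cong-bounded g≈g′ σ≗σ′ (b ∷ bs) = cong₂ _∷_ (mapT-cong-bounded g≈g′ σ≗σ′ b) (mapTs-cong-bounded g≈g′ σ≗σ′ bs)

mutual
  size : ∀ {V : Set} → Term ℕ V → ℕ
  size (var x)   = 0
  size (fn f ts) = suc f + sizes ts

  sizes : ∀ {V : Set} → List (Term ℕ V) → ℕ
  sizes []       = 0
  sizes (t ∷ ts) = size t + sizes ts

mutual
  bounded-by-size : ∀ {V : Set} {N} (t : Term ℕ V) → size t ≤ N → Bounded N t
  bounded-by-size (var x)   _  = var
  bounded-by-size (fn f ts) le = fn (m+n≤o⇒m≤o (suc f) le) (bounded-by-sizes ts (m+n≤o⇒n≤o (suc f) le))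

  bounded-by-sizes : ∀ {V : Set} {N} (ts : List (Term ℕ V)) → sizes ts ≤ N → All (Bounded N) ts
  bounded-by-sizes []       _  = []
  bounded-by-sizes (t ∷ ts) le =
    bounded-by-size t (m+n≤o⇒m≤o (size t) le) ∷ bounded-by-sizes ts (m+n≤o⇒n≤o (size t) le)

instantiate-ground : ∀ {F V : Set} (σ : V → Term F ⊥) (t : Term F ⊥) → mapT id σ (mapT id (λ ()) t) ≡ t
instantiate-ground σ t = trans (mapT-∘ id σ id (λ ()) t) (mapT-identity (λ _ → refl) (λ ()) t)

dummy : MTerm ⊥
dummy = fn nilS []

listSubst : List (MTerm ⊥) → MSubst
listSubst []       _       = dummy
listSubst (u ∷ us) zero    = u
listSubst (u ∷ us) (suc i) = listSubst us i

listSubst-upTo : (us : List (MTerm ⊥)) {n : ℕ} → length us ≡ n → mapTs id (listSubst us) (map var (upTo n)) ≡ us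
listSubst-upTo us refl = begin
  mapTs id (listSubst us) (map var (upTo (length us))) ≡⟨ mapTs-vars (upTo (length us)) ⟩
  map (listSubst us) (upTo (length us))                ≡⟨ map-upTo (listSubst us) (length us) ⟩
  applyUpTo (listSubst us) (length us)                 ≡⟨ applyUpTo-listSubst us ⟩
  us                                                   ∎
  where
  mapTs-vars : ∀ is → mapTs id (listSubst us) (map var is) ≡ map (listSubst us) is
  mapTs-vars []       = refl
  mapTs-vars (i ∷ is) = cong (listSubst us i ∷_) (mapTs-vars is)

  applyUpTo-listSubst : ∀ us → applyUpTo (listSubst us) (length us) ≡ us
  applyUpTo-listSubst []       = refl
  applyUpTo-listSubst (u ∷ us) = cong (u ∷_) (applyUpTo-listSubst us)

-- The shape f * 4 + k makes code (s (suc f)) unfold to four more suc's than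
-- code (s f), matching the recursion of decodeIndexed.
code : MFun → ℕ
code nilS      = 0
code consS     = 1
code (dsym f)  = 2 + (f * 4 + 0)
code (predS f) = 2 + (f * 4 + 1)
code (notS f)  = 2 + (f * 4 + 2)
code (labS f)  = 2 + (f * 4 + 3)

successor : MFun → MFun
successor (dsym f)  = dsym (suc f)
successor (predS f) = predS (suc f)
successor (notS f)  = notS (suc f)
successor (labS f)  = labS (suc f)
successor m         = m

decodeIndexed : ℕ → MFun
decodeIndexed 0                         = dsym 0
decodeIndexed 1                         = predS 0
decodeIndexed 2                         = notS 0
decodeIndexed 3                         = labS 0
decodeIndexed (suc (suc (suc (suc n)))) = successor (decodeIndexed n)

decode : ℕ → MFun
decode 0             = nilS
decode 1             = consS
decode (suc (suc n)) = decodeIndexed n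

decodeIndexed-family : ∀ k (s : ℕ → MFun) → (∀ f → successor (s f) ≡ s (suc f)) →
                       decodeIndexed k ≡ s 0 → ∀ f → decodeIndexed (f * 4 + k) ≡ s f
decodeIndexed-family k s next start zero    = start
decodeIndexed-family k s next start (suc f) =
  trans (cong successor (decodeIndexed-family k s next start f)) (next f)

decode-code : ∀ m → decode (code m) ≡ m
decode-code nilS      = refl
decode-code consS     = refl
decode-code (dsym f)  = decodeIndexed-family 0 dsym (λ _ → refl) refl f
decode-code (predS f) = decodeIndexed-family 1 predS (λ _ → refl) refl f
decode-code (notS f)  = decodeIndexed-family 2 notS (λ _ → refl) refl f
decode-code (labS f)  = decodeIndexed-family 3 labS (λ _ → refl) refl f

module SymbolCoding (N : ℕ) where

  symbolIndex : MFun → ℕ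
  symbolIndex (dsym f) with f <? N
  ... | yes _ = f
  ... | no _  = N + code (dsym f)
  symbolIndex m = N + code m

  indexSymbol : ℕ → MFun
  indexSymbol n with n <? N
  ... | yes _ = dsym n
  ... | no _  = decode (n ∸ N)

  symbolIndex-below : ∀ f → f < N → symbolIndex (dsym f) ≡ f
  symbolIndex-below f f<N with f <? N
  ... | yes _   = refl
  ... | no f≮N = ⊥-elim (f≮N f<N)

  indexSymbol-below : ∀ f → f < N → indexSymbol f ≡ dsym f
  indexSymbol-below f f<N with f <? N
  ... | yes _   = refl
  ... | no f≮N = ⊥-elim (f≮N f<N)

  indexSymbol-above : ∀ c → indexSymbol (N + c) ≡ decode c
  indexSymbol-above c with N + c <? N
  ... | yes N+c<N = ⊥-elim (<⇒≱ N+c<N (m≤m+n N c))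
  ... | no _      = cong decode (m+n∸m≡n N c)

  indexSymbol-symbolIndex : ∀ m → indexSymbol (symbolIndex m) ≡ m
  indexSymbol-symbolIndex (dsym f) with f <? N
  ... | yes f<N = indexSymbol-below f f<N
  ... | no _    = trans (indexSymbol-above (code (dsym f))) (decode-code (dsym f))
  indexSymbol-symbolIndex nilS      = trans (indexSymbol-above _) (decode-code nilS)
  indexSymbol-symbolIndex consS     = trans (indexSymbol-above _) (decode-code consS)
  indexSymbol-symbolIndex (predS f) = trans (indexSymbol-above _) (decode-code (predS f))
  indexSymbol-symbolIndex (notS f)  = trans (indexSymbol-above _) (decode-code (notS f))
  indexSymbol-symbolIndex (labS f)  = trans (indexSymbol-above _) (decode-code (labS f))

BoundedLit : ∀ {V : Set} → ℕ → Lit V → Set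
BoundedLit N l = All (Bounded N) (Lit.args l)

record BoundedTheory (N : ℕ) (D : Theory) : Set where
  field
    fact-bounded       : ∀ {q} → q ∈ facts D → BoundedLit N q
    consequent-bounded : ∀ {ρ} → ρ ∈ rules D → BoundedLit N (consequent ρ)
    antecedent-bounded : ∀ {ρ} → ρ ∈ rules D → All (BoundedLit N) (antecedent ρ)

litSize : ∀ {V : Set} → Lit V → ℕ
litSize l = sizes (Lit.args l)

ruleSize : Rule → ℕ
ruleSize ρ = litSize (consequent ρ) + sum (map litSize (antecedent ρ))

theorySize : Theory → ℕ
theorySize D = sum (map litSize (facts D)) + sum (map ruleSize (rules D))

∈⇒≤sum : ∀ {n ns} → n ∈ ns → n ≤ sum ns
∈⇒≤sum {ns = n ∷ ns} (here refl) = m≤m+n n (sum ns)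
∈⇒≤sum {ns = m ∷ ns} (there n∈) = ≤-trans (∈⇒≤sum n∈) (m≤n+m (sum ns) m)

boundedLit-size : ∀ {V : Set} k (l : Lit V) → BoundedLit (k + litSize l) l
boundedLit-size k l = bounded-by-sizes (Lit.args l) (m≤n+m (litSize l) k)

boundedTheory : ∀ D k → BoundedTheory (theorySize D + k) D
boundedTheory D k = record
  { fact-bounded       = λ {q} q∈ → bounded-by-sizes (Lit.args q) (≤-trans (∈⇒≤sum (∈-map⁺ litSize q∈)) facts≤)
  ; consequent-bounded = λ ρ∈ → bounded-by-sizes _ (≤-trans (m≤m+n _ _) (rule≤ ρ∈))
  ; antecedent-bounded = λ ρ∈ → All.tabulate λ {l} l∈ →
      bounded-by-sizes (Lit.args l)
        (≤-trans (∈⇒≤sum (∈-map⁺ litSize l∈)) (≤-trans (m≤n+m _ _) (rule≤ ρ∈)))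
  }
  where
  facts≤ : sum (map litSize (facts D)) ≤ theorySize D + k
  facts≤ = ≤-trans (m≤m+n _ _) (m≤m+n _ k)

  rule≤ : ∀ {ρ} → ρ ∈ rules D → ruleSize ρ ≤ theorySize D + k
  rule≤ ρ∈ = ≤-trans (∈⇒≤sum (∈-map⁺ ruleSize ρ∈)) (≤-trans (m≤n+m _ _) (m≤m+n _ k))

sig-substL : ∀ (τ : DSubst) l → sig (substL τ l) ≡ sig l
sig-substL τ (lit b p ts) = cong (p ,_) (length-mapTs id τ ts)

encodeLitWith : (ℕ → MFun) → GLit → MTerm ⊥
encodeLitWith g (lit true p ts)  = fn (predS p) (mapTs g var ts)
encodeLitWith g (lit false p ts) = fn (notS p) (mapTs g var ts)

encodeLitsWith : (ℕ → MFun) → List GLit → MTerm ⊥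
encodeLitsWith g []       = fn nilS []
encodeLitsWith g (l ∷ ls) = fn consS (encodeLitWith g l ∷ encodeLitsWith g ls ∷ [])

encL-dsym : ∀ q → encL q ≡ encodeLitWith dsym q
encL-dsym (lit true _ _)  = refl
encL-dsym (lit false _ _) = refl

module Decoding (N : ℕ) where
  open SymbolCoding N public

  decodeLit : MTerm ⊥ → GLit
  decodeLit (fn (predS p) ts) = lit true p (mapTs symbolIndex var ts)
  decodeLit (fn (notS p) ts)  = lit false p (mapTs symbolIndex var ts)
  decodeLit _                 = lit true 0 []

  decodeLits : MTerm ⊥ → List GLit
  decodeLits (fn consS (t ∷ ts ∷ [])) = decodeLit t ∷ decodeLits ts
  decodeLits _                        = []

  decode-instance-args : (σ : MSubst) {ts : List (Term ℕ ℕ)} → All (Bounded N) ts →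
    mapTs symbolIndex var (mapTs id σ (mapTs dsym var ts)) ≡ mapTs id (mapT symbolIndex var ∘ σ) ts
  decode-instance-args σ {ts} b = begin
    mapTs symbolIndex var (mapTs id σ (mapTs dsym var ts))  ≡⟨ cong (mapTs symbolIndex var) (mapTs-∘ id σ dsym var ts) ⟩
    mapTs symbolIndex var (mapTs dsym σ ts)                 ≡⟨ mapTs-∘ symbolIndex var dsym σ ts ⟩
    mapTs (symbolIndex ∘ dsym) (mapT symbolIndex var ∘ σ) ts ≡⟨ mapTs-cong-bounded symbolIndex-below (λ _ → refl) b ⟩
    mapTs id (mapT symbolIndex var ∘ σ) ts                  ∎

  decode-instance : (σ : MSubst) (l : Lit ℕ) → BoundedLit N l →
    decodeLit (mapT id σ (encL l)) ≡ substL (mapT symbolIndex var ∘ σ) l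
  decode-instance σ (lit true p ts)  b = cong (lit true p) (decode-instance-args σ b)
  decode-instance σ (lit false p ts) b = cong (lit false p) (decode-instance-args σ b)

  decode-instances : (σ : MSubst) (ls : List (Lit ℕ)) → All (BoundedLit N) ls →
    decodeLits (mapT id σ (encLs ls)) ≡ map (substL (mapT symbolIndex var ∘ σ)) ls
  decode-instances σ []       []       = refl
  decode-instances σ (l ∷ ls) (b ∷ bs) = cong₂ _∷_ (decode-instance σ l b) (decode-instances σ ls bs)

  decode-encode-args : {ts : List (Term ℕ ⊥)} → All (Bounded N) ts → mapTs symbolIndex var (mapTs dsym var ts) ≡ ts
  decode-encode-args {ts} b = begin
    mapTs symbolIndex var (mapTs dsym var ts) ≡⟨ mapTs-∘ symbolIndex var dsym var ts ⟩
    mapTs (symbolIndex ∘ dsym) var ts         ≡⟨ mapTs-cong-bounded symbolIndex-below (λ ()) b ⟩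
    mapTs id var ts                           ≡⟨ mapTs-identity (λ _ → refl) (λ ()) ts ⟩
    ts                                        ∎

  decodeLit-encL : (q : GLit) → BoundedLit N q → decodeLit (encL q) ≡ q
  decodeLit-encL (lit true p ts)  b = cong (lit true p) (decode-encode-args b)
  decodeLit-encL (lit false p ts) b = cong (lit false p) (decode-encode-args b)

  encode-decode-args : (ts : List (MTerm ⊥)) → mapTs indexSymbol var (mapTs symbolIndex var ts) ≡ ts
  encode-decode-args ts = trans (mapTs-∘ indexSymbol var symbolIndex var ts)
                                (mapTs-identity indexSymbol-symbolIndex (λ ()) ts)

module MetaClauses (D : Theory) where

  fact∈Meta : ∀ {q} → q ∈ facts D → factClause q ∈ Meta D
  fact∈Meta q∈ = ∈-++⁺ˡ (∈-map⁺ factClause q∈)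

  rule∈Meta : ∀ {ρ} → ρ ∈ rules D → ruleClause ρ ∈ Meta D
  rule∈Meta ρ∈ = ∈-++⁺ʳ (map factClause (facts D)) (∈-++⁺ˡ (∈-map⁺ ruleClause ρ∈))

  neg∈Meta : ∀ {c pn} → c ∈ negClauses pn → pn ∈ preds D → c ∈ Meta D
  neg∈Meta c∈ pn∈ = ∈-++⁺ʳ (map factClause (facts D)) (∈-++⁺ʳ (map ruleClause (rules D))
    (∈-++⁺ʳ (map supClause (sup D)) (∈-++⁺ˡ (∈-concatMap⁺ negClauses (lose pn∈ c∈)))))

  fixed∈Meta : ∀ {c} → c ∈ fixedClauses → c ∈ Meta D
  fixed∈Meta c∈ = ∈-++⁺ʳ (map factClause (facts D)) (∈-++⁺ʳ (map ruleClause (rules D))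
    (∈-++⁺ʳ (map supClause (sup D)) (∈-++⁺ʳ (concatMap negClauses (preds D)) c∈)))

  consequent∈preds : ∀ {ρ} → ρ ∈ rules D → (τ : DSubst) → sig (substL τ (consequent ρ)) ∈ preds D
  consequent∈preds {ρ} ρ∈ τ = subst (_∈ preds D) (sym (sig-substL τ (consequent ρ)))
    (∈-++⁺ʳ (map sig (facts D)) (∈-concatMap⁺ (λ r → sig (consequent r) ∷ map sig (antecedent r)) (lose ρ∈ (here refl))))

-- Stated for any renaming g fixing the symbols of D: closedness of the
-- soundness invariant needs it for g = indexSymbol, the theorem for g = dsym.
module Completeness {N : ℕ} (D : Theory) (bounded : BoundedTheory N D)
                    (g : ℕ → MFun) (g-below : ∀ f → f < N → dsym f ≡ g f) (I : GAtom → Set) where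
  open BoundedTheory bounded
  open MetaClauses D

  Derivable : GAtom → Set
  Derivable = Γ (Meta D) I

  derive : ∀ {c a} → c ∈ Meta D → (σ : MSubst) →
           All (λ b → ¬ I (instA σ b)) (Clause.negBody c) → All (λ b → Derivable (instA σ b)) (Clause.posBody c) →
           instA σ (Clause.head c) ≡ a → Derivable a
  derive c∈ σ negs poss refl = apply c∈ σ negs poss


  Enc : GLit → MTerm ⊥
  Enc = encodeLitWith g

  Encs : List GLit → MTerm ⊥
  Encs = encodeLitsWith g

  encode-instance-args : (τ : DSubst) {ts : List (Term ℕ ℕ)} → All (Bounded N) ts →
    mapTs id (mapT g var ∘ τ) (mapTs dsym var ts) ≡ mapTs g var (mapTs id τ ts)
  encode-instance-args τ {ts} b = begin
    mapTs id (mapT g var ∘ τ) (mapTs dsym var ts) ≡⟨ mapTs-∘ id (mapT g var ∘ τ) dsym var ts ⟩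
    mapTs dsym (mapT g var ∘ τ) ts               ≡⟨ mapTs-cong-bounded g-below (λ _ → refl) b ⟩
    mapTs g (mapT g var ∘ τ) ts                  ≡⟨ mapTs-∘ g var id τ ts ⟨
    mapTs g var (mapTs id τ ts)                  ∎

  encode-instance : (τ : DSubst) (l : Lit ℕ) → BoundedLit N l →
                    mapT id (mapT g var ∘ τ) (encL l) ≡ Enc (substL τ l)
  encode-instance τ (lit true p ts)  b = cong (fn (predS p)) (encode-instance-args τ b)
  encode-instance τ (lit false p ts) b = cong (fn (notS p)) (encode-instance-args τ b)

  encode-instances : (τ : DSubst) (ls : List (Lit ℕ)) → All (BoundedLit N) ls →
                     mapT id (mapT g var ∘ τ) (encLs ls) ≡ Encs (map (substL τ) ls)
  encode-instances τ []       []       = refl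
  encode-instances τ (l ∷ ls) (b ∷ bs) =
    cong₂ (λ t u → fn consS (t ∷ u ∷ [])) (encode-instance τ l b) (encode-instances τ ls bs)

  encL≡Enc : (q : GLit) → BoundedLit N q → encL q ≡ Enc q
  encL≡Enc (lit true p ts)  b = cong (fn (predS p)) (mapTs-cong-bounded g-below (λ ()) b)
  encL≡Enc (lit false p ts) b = cong (fn (notS p)) (mapTs-cong-bounded g-below (λ ()) b)

  fact-atom : ∀ {q} → q ∈ facts D → Derivable (factP ⦅ Enc q ∷ [] ⦆)
  fact-atom {q} q∈ = derive (fact∈Meta q∈) (λ _ → dummy) [] []
    (cong (λ t → factP ⦅ t ∷ [] ⦆) (trans (instantiate-ground _ (encL q)) (encL≡Enc q (fact-bounded q∈))))

  rule-atom : ∀ {ρ} → ρ ∈ rules D → (τ : DSubst) →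
    Derivable (kindPred (kind ρ) ⦅ lab (label ρ) ∷ Enc (substL τ (consequent ρ)) ∷ Encs (map (substL τ) (antecedent ρ)) ∷ [] ⦆)
  rule-atom {ρ} ρ∈ τ = derive (rule∈Meta ρ∈) (mapT g var ∘ τ) [] []
    (cong₂ (λ t u → kindPred (kind ρ) ⦅ lab (label ρ) ∷ t ∷ u ∷ [] ⦆)
      (encode-instance τ (consequent ρ) (consequent-bounded ρ∈))
      (encode-instances τ (antecedent ρ) (antecedent-bounded ρ∈)))

  strictOrDefeasible-atom : ∀ {k r h b} → StrictOrDefeasible k →
    Derivable (kindPred k ⦅ r ∷ h ∷ b ∷ [] ⦆) → Derivable (strictOrDefeasibleP ⦅ r ∷ h ∷ b ∷ [] ⦆)
  strictOrDefeasible-atom {r = r} {h} {b} isStrict γ =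
    apply (fixed∈Meta (∈-lookup (# 2))) (listSubst (r ∷ h ∷ b ∷ [])) [] (γ ∷ [])
  strictOrDefeasible-atom {r = r} {h} {b} isDefeasible γ =
    apply (fixed∈Meta (∈-lookup (# 3))) (listSubst (r ∷ h ∷ b ∷ [])) [] (γ ∷ [])

  loop-atom : ∀ {loopP τ ys} → (∀ {c} → c ∈ loopClauses loopP τ → c ∈ Meta D) →
    All (λ y → Derivable (τ ⦅ Enc y ∷ [] ⦆)) ys → Derivable (loopP ⦅ Encs ys ∷ [] ⦆)
  loop-atom loop∈ [] = apply (loop∈ (here refl)) (λ _ → dummy) [] []
  loop-atom {ys = y ∷ ys} loop∈ (γ ∷ γs) =
    apply (loop∈ (there (here refl))) (λ { 1 → Enc y ; 8 → Encs ys ; _ → dummy }) [] (γ ∷ loop-atom loop∈ γs ∷ [])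

  neg-atom : (y : GLit) → sig y ∈ preds D → Derivable (negP ⦅ Enc y ∷ Enc (∼ y) ∷ [] ⦆)
  neg-atom (lit true p ts) s∈ = derive (neg∈Meta (here refl) s∈) (listSubst (mapTs g var ts)) [] []
    (cong (λ us → negP ⦅ fn (predS p) us ∷ fn (notS p) us ∷ [] ⦆) (listSubst-upTo (mapTs g var ts) (length-mapTs g var ts)))
  neg-atom (lit false p ts) s∈ = derive (neg∈Meta (there (here refl)) s∈) (listSubst (mapTs g var ts)) [] []
    (cong (λ us → negP ⦅ fn (notS p) us ∷ fn (predS p) us ∷ [] ⦆) (listSubst-upTo (mapTs g var ts) (length-mapTs g var ts)))

  loopDefinitely∈Meta : ∀ {c} → c ∈ loopClauses loopDefinitelyP definitelyP → c ∈ Meta D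
  loopDefinitely∈Meta (here refl)         = fixed∈Meta (∈-lookup (# 12))
  loopDefinitely∈Meta (there (here refl)) = fixed∈Meta (∈-lookup (# 13))

  loopLambda∈Meta : ∀ {c} → c ∈ loopClauses loopLambdaP lambdaP → c ∈ Meta D
  loopLambda∈Meta (here refl)         = fixed∈Meta (∈-lookup (# 14))
  loopLambda∈Meta (there (here refl)) = fixed∈Meta (∈-lookup (# 15))

  mutual
    definitely-complete : ∀ {y} → PΔ D y → Derivable (definitelyP ⦅ Enc y ∷ [] ⦆)
    definitely-complete (fromFact {q} q∈) =
      apply (fixed∈Meta (∈-lookup (# 4))) (λ { 3 → Enc q ; _ → dummy }) [] (fact-atom q∈ ∷ [])
    definitely-complete (fromStrict {ρ} ρ∈ strict τ ds) =
      apply (fixed∈Meta (∈-lookup (# 5)))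
        (λ { 0 → lab (label ρ) ; 3 → Enc (substL τ (consequent ρ)) ; 5 → Encs (map (substL τ) (antecedent ρ)) ; _ → dummy })
        [] (subst (λ k → Derivable (kindPred k ⦅ _ ⦆)) strict (rule-atom ρ∈ τ)
            ∷ loop-atom loopDefinitely∈Meta (definitely-complete-all ds) ∷ [])

    definitely-complete-all : ∀ {ys} → All (PΔ D) ys → All (λ y → Derivable (definitelyP ⦅ Enc y ∷ [] ⦆)) ys
    definitely-complete-all []       = []
    definitely-complete-all (d ∷ ds) = definitely-complete d ∷ definitely-complete-all ds

  module _ (excluded : ∀ y → ¬ PΔ D y → ¬ I (definitelyP ⦅ Enc y ∷ [] ⦆)) where
    mutual
      lambda-complete : ∀ {y} → Pλ D y → Derivable (lambdaP ⦅ Enc y ∷ [] ⦆)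
      lambda-complete (fromΔ {y} d) =
        apply (fixed∈Meta (∈-lookup (# 6))) (λ { 3 → Enc y ; _ → dummy }) [] (definitely-complete d ∷ [])
      lambda-complete (fromRule {ρ} ρ∈ sd τ ls ¬d) =
        apply (fixed∈Meta (∈-lookup (# 7)))
          (λ { 0 → lab (label ρ) ; 3 → Enc x ; 4 → Enc (∼ x) ; 5 → Encs (map (substL τ) (antecedent ρ)) ; _ → dummy })
          (excluded (∼ x) ¬d ∷ [])
          (neg-atom x (consequent∈preds ρ∈ τ) ∷ strictOrDefeasible-atom sd (rule-atom ρ∈ τ)
            ∷ loop-atom loopLambda∈Meta (lambda-complete-all ls) ∷ [])
        where x = substL τ (consequent ρ)

      lambda-complete-all : ∀ {ys} → All (Pλ D) ys → All (λ y → Derivable (lambdaP ⦅ Enc y ∷ [] ⦆)) ys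
      lambda-complete-all []       = []
      lambda-complete-all (d ∷ ds) = lambda-complete d ∷ lambda-complete-all ds

-- The λ-part of the invariant is guarded by Hλ. With Hλ = ⊥ it is vacuous, so
-- soundness of definitely holds for every interpretation I; with Hλ = ⊤ it needs
-- every definitely(y), y ∈ P_Δ, in I, to read back a negative literal not definitely(X′).
module Soundness {N : ℕ} (D : Theory) (bounded : BoundedTheory N D) (Hλ : Set) where
  open Decoding N public
  open BoundedTheory bounded
  open MetaClauses D

  GroundRule : (Kind → Set) → MTerm ⊥ → MTerm ⊥ → Set
  GroundRule K h b = Σ Rule λ ρ → ρ ∈ rules D × K (kind ρ) × Σ DSubst λ τ →
    decodeLit h ≡ substL τ (consequent ρ) × decodeLits b ≡ map (substL τ) (antecedent ρ)

  GroundRule-map : ∀ {K K′ h b} → (∀ {k} → K k → K′ k) → GroundRule K h b → GroundRule K′ h b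
  GroundRule-map f (ρ , ρ∈ , k , rest) = ρ , ρ∈ , f k , rest

  Holds : GAtom → Set
  Holds (factP ⦅ t ∷ [] ⦆)                          = decodeLit t ∈ facts D
  Holds (strictP ⦅ r ∷ h ∷ b ∷ [] ⦆)                = GroundRule (_≡ strictK) h b
  Holds (defeasibleP ⦅ r ∷ h ∷ b ∷ [] ⦆)            = GroundRule (_≡ defeasibleK) h b
  Holds (strictOrDefeasibleP ⦅ r ∷ h ∷ b ∷ [] ⦆)    = GroundRule StrictOrDefeasible h b
  Holds (negP ⦅ x ∷ x′ ∷ [] ⦆)                      = (decodeLit x′ ≡ ∼ decodeLit x) × (encodeLitWith indexSymbol (decodeLit x′) ≡ x′)
  Holds (loopDefinitelyP ⦅ t ∷ [] ⦆)                = All (PΔ D) (decodeLits t)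
  Holds (loopLambdaP ⦅ t ∷ [] ⦆)                    = Hλ → All (Pλ D) (decodeLits t)
  Holds (definitelyP ⦅ t ∷ [] ⦆)                    = PΔ D (decodeLit t)
  Holds (lambdaP ⦅ t ∷ [] ⦆)                        = Hλ → Pλ D (decodeLit t)
  Holds _                                            = ⊤

  rule-instance : ∀ {ρ K} → ρ ∈ rules D → (σ : MSubst) → K (kind ρ) →
                  GroundRule K (mapT id σ (encL (consequent ρ))) (mapT id σ (encLs (antecedent ρ)))
  rule-instance {ρ} ρ∈ σ k = ρ , ρ∈ , k , mapT symbolIndex var ∘ σ ,
    decode-instance σ (consequent ρ) (consequent-bounded ρ∈) , decode-instances σ (antecedent ρ) (antecedent-bounded ρ∈)

  module Derivations (I : GAtom → Set)
                     (definite : Hλ → ∀ y → PΔ D y → I (definitelyP ⦅ encodeLitWith indexSymbol y ∷ [] ⦆)) where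

    ClauseSound : Clause → Set
    ClauseSound c = ∀ σ → All (λ a → ¬ I (instA σ a)) (Clause.negBody c) →
                    All (λ a → Holds (instA σ a)) (Clause.posBody c) → Holds (instA σ (Clause.head c))

    ¬definitely⇒¬PΔ : ∀ {x x′} → ¬ I (definitelyP ⦅ x′ ∷ [] ⦆) → Holds (negP ⦅ x ∷ x′ ∷ [] ⦆) →
                      Hλ → ¬ PΔ D (∼ decodeLit x)
    ¬definitely⇒¬PΔ ¬γ (x′≡∼x , x′-encoded) h d =
      ¬γ (subst (λ t → I (definitelyP ⦅ t ∷ [] ⦆)) x′-encoded (definite h _ (subst (PΔ D) (sym x′≡∼x) d)))

    fact-sound : ∀ {q} → q ∈ facts D → ClauseSound (factClause q)
    fact-sound {q} q∈ σ _ _ =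
      subst (_∈ facts D) (sym (trans (cong decodeLit (instantiate-ground σ (encL q))) (decodeLit-encL q (fact-bounded q∈)))) q∈

    rule-sound : ∀ {ρ} → ρ ∈ rules D → ClauseSound (ruleClause ρ)
    rule-sound {ρ} ρ∈ σ _ _ with kind ρ in eq
    ... | strictK     = rule-instance ρ∈ σ eq
    ... | defeasibleK = rule-instance ρ∈ σ eq
    ... | defeaterK   = tt

    sup-sound : ∀ s → ClauseSound (supClause s)
    sup-sound _ _ _ _ = tt

    neg-sound : ∀ pn → All ClauseSound (negClauses pn)
    neg-sound (p , n) = (λ _ _ _ → refl , cong (fn (notS p)) (encode-decode-args _))
                      ∷ (λ _ _ _ → refl , cong (fn (predS p)) (encode-decode-args _))
                      ∷ []

    fixed-sound : All ClauseSound fixedClauses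
    fixed-sound =
        (λ _ _ _ → tt)
      ∷ (λ _ _ _ → tt)
      ∷ (λ { _ _ (r ∷ []) → GroundRule-map (λ { refl → isStrict }) r })
      ∷ (λ { _ _ (r ∷ []) → GroundRule-map (λ { refl → isDefeasible }) r })
      ∷ (λ { _ _ (q∈ ∷ []) → fromFact q∈ })
      ∷ (λ { _ _ ((ρ , ρ∈ , strict , τ , h≡ , b≡) ∷ ds ∷ []) →
               subst (PΔ D) (sym h≡) (fromStrict ρ∈ strict τ (subst (All (PΔ D)) b≡ ds)) })
      ∷ (λ { _ _ (d ∷ []) _ → fromΔ d })
      ∷ (λ { σ (¬γ ∷ []) (neg ∷ (ρ , ρ∈ , sd , τ , h≡ , b≡) ∷ ls ∷ []) h →
               subst (Pλ D) (sym h≡) (fromRule ρ∈ sd τ (subst (All (Pλ D)) b≡ (ls h))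
                 (subst (λ l → ¬ PΔ D (∼ l)) h≡ (¬definitely⇒¬PΔ {σ 3} ¬γ neg h))) })
      ∷ (λ _ _ _ → tt)
      ∷ (λ _ _ _ → tt)
      ∷ (λ _ _ _ → tt)
      ∷ (λ _ _ _ → tt)
      ∷ (λ _ _ _ → [])
      ∷ (λ { _ _ (d ∷ ds ∷ []) → d ∷ ds })
      ∷ (λ _ _ _ _ → [])
      ∷ (λ { _ _ (d ∷ ds ∷ []) h → d h ∷ ds h })
      ∷ (λ _ _ _ → tt)
      ∷ (λ _ _ _ → tt)
      ∷ []

    meta-sound : All ClauseSound (Meta D)
    meta-sound = ++⁺ (map⁺ (All.tabulate fact-sound)) (++⁺ (map⁺ (All.tabulate rule-sound))
      (++⁺ (map⁺ (All.universal sup-sound (sup D))) (++⁺ (concat⁺ (map⁺ (All.universal neg-sound (preds D)))) fixed-sound)))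

    mutual
      sound : ∀ {a} → Γ (Meta D) I a → Holds a
      sound (apply c∈ σ negs poss) = All.lookup meta-sound c∈ σ negs (sound-all poss)

      sound-all : ∀ {σ as} → All (λ a → Γ (Meta D) I (instA σ a)) as → All (λ a → Holds (instA σ a)) as
      sound-all []       = []
      sound-all (γ ∷ γs) = sound γ ∷ sound-all γs

⊨WF-intro : ∀ {P a} → (∀ S → Γ P (Γ P S) a) → P ⊨WF a
⊨WF-intro γ S closed = closed _ (γ S)

module _ (D : Theory) where

  private
    module CompleteFor (I : GAtom → Set) =
      Completeness D (boundedTheory D 0) dsym (λ _ _ → refl) I

  ¬PΔ⇒¬definitely : ∀ S y → ¬ PΔ D y → ¬ Γ (Meta D) S (definitelyP ⦅ encodeLitWith dsym y ∷ [] ⦆)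
  ¬PΔ⇒¬definitely S y ¬d γ =
    ¬d (subst (PΔ D) (decodeLit-encL y (boundedLit-size (theorySize D) y))
         (subst (PΔ D ∘ decodeLit) (sym (encL-dsym y)) (sound γ)))
    where
    open Soundness D (boundedTheory D (litSize y)) ⊥
    open Derivations S (λ ())

  PΔ⇒⊨definitely : ∀ {q} → PΔ D q → Meta D ⊨WF (definitelyP ⦅ encL q ∷ [] ⦆)
  PΔ⇒⊨definitely {q} d = ⊨WF-intro λ S →
    subst (λ t → Γ (Meta D) (Γ (Meta D) S) (definitelyP ⦅ t ∷ [] ⦆)) (sym (encL-dsym q))
      (CompleteFor.definitely-complete (Γ (Meta D) S) d)

  Pλ⇒⊨lambda : ∀ {q} → Pλ D q → Meta D ⊨WF (lambdaP ⦅ encL q ∷ [] ⦆)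
  Pλ⇒⊨lambda {q} d = ⊨WF-intro λ S →
    subst (λ t → Γ (Meta D) (Γ (Meta D) S) (lambdaP ⦅ t ∷ [] ⦆)) (sym (encL-dsym q))
      (CompleteFor.lambda-complete (Γ (Meta D) S) (¬PΔ⇒¬definitely S) d)

  module _ (q : GLit) where
    open Soundness D (boundedTheory D (litSize q)) ⊤

    Holds-closed : ∀ a → Γ (Meta D) (Γ (Meta D) Holds) a → Holds a
    Holds-closed _ = Derivations.sound (Γ (Meta D) Holds) λ _ _ d →
      Completeness.definitely-complete D (boundedTheory D (litSize q)) indexSymbol
        (λ f f<N → sym (indexSymbol-below f f<N)) Holds d

    ⊨definitely⇒PΔ : Meta D ⊨WF (definitelyP ⦅ encL q ∷ [] ⦆) → PΔ D q
    ⊨definitely⇒PΔ w = subst (PΔ D) (decodeLit-encL q (boundedLit-size (theorySize D) q)) (w Holds Holds-closed)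

    ⊨lambda⇒Pλ : Meta D ⊨WF (lambdaP ⦅ encL q ∷ [] ⦆) → Pλ D q
    ⊨lambda⇒Pλ w = subst (Pλ D) (decodeLit-encL q (boundedLit-size (theorySize D) q)) (w Holds Holds-closed tt)

theorem3 : (D : Theory) → Acyclic D → (q : GLit) → sig q ∈ preds D →
    (PΔ D q ⇔ (Meta D ⊨WF (definitelyP ⦅ encL q ∷ [] ⦆)))
    × (Pλ D q ⇔ (Meta D ⊨WF (lambdaP ⦅ encL q ∷ [] ⦆)))
theorem3 D _ q _ = mk⇔ (PΔ⇒⊨definitely D) (⊨definitely⇒PΔ D q) , mk⇔ (Pλ⇒⊨lambda D) (⊨lambda⇒Pλ D q)
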